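{- Let $V$ be a finite nonempty set and $f$ a Boolean network on $V$ that is even or odd. Then for every $x\in\mathbb{B}^V$, every vertex of the local interaction graph $Gf(x)$ has odd out-degree. In particular $Gf(x)$ has a cycle.
   Context: $\mathbb{B}=\{0,1\}$, $\oplus$ componentwise addition mod 2. A point is even (resp. odd) if its number of ones is even (resp. odd). A network on $V$ is $f:\mathbb{B}^V\to\mathbb{B}^V$ with components $f_i$; its conjugate is $\tilde f(x)=f(x)\oplus x$; $f$ is even (resp. odd) if $\tilde f(\mathbb{B}^V)$ is exactly the set of even (resp. odd) points of $\mathbb{B}^V$. For $x\in\mathbb{B}^V$, $x^{j\alpha}$ is $x$ with $j$-component set to $\alpha$; $f_{ij}(x)=f_i(x^{j1})-f_i(x^{j0})$. $Gf(x)$ is the signed digraph on $V$ with a positive (resp. negative) arc from $j$ to $i$ when $f_{ij}(x)=1$ (resp. $-1$), loops allowed; the out-degree of $j$ is the number of $i$ with $f_{ij}(x)\neq 0$. A cycle is a subgraph whose underlying unsigned digraph is a directed cycle (a loop counts as a cycle). -}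

module Defs where

open import Data.Nat using (ℕ; zero; suc; _+_; _%_)
open import Data.Bool using (Bool; true; false; _xor_; if_then_else_)
open import Data.Fin using (Fin; zero; suc; inject₁; fromℕ; _≟_)
open import Data.List using (List; length; filter)
open import Data.List using (allFin)
open import Data.Product using (Σ; ∃; _×_; _,_)
open import Data.Empty using (⊥)
open import Relation.Nullary using (¬_; Dec; yes; no; ¬?)
open import Relation.Binary.PropositionalEquality using (_≡_; _≢_)
open import Function.Bundles using (_⇔_)
open import Function.Definitions using (Injective)
open import Data.Bool.Properties using () renaming (_≟_ to _≟ᵇ_)


Point : ℕ → Set
Point n = Fin n → Bool

Network : ℕ → Set
Network n = Point n → Point n

weight : ∀ {n} → Point n → ℕ
weight {n} x = length (filter (λ i → x i ≟ᵇ true) (allFin n))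

IsEvenPt : ∀ {n} → Point n → Set
IsEvenPt x = weight x % 2 ≡ 0

IsOddPt : ∀ {n} → Point n → Set
IsOddPt x = weight x % 2 ≡ 1

conj : ∀ {n} → Network n → Network n
conj f x i = f x i xor x i

InImage : ∀ {n} → Network n → Point n → Set
InImage {n} g y = Σ (Point n) λ x → ∀ i → g x i ≡ y i

IsEvenNet : ∀ {n} → Network n → Set
IsEvenNet f = ∀ y → InImage (conj f) y ⇔ IsEvenPt y

IsOddNet : ∀ {n} → Network n → Set
IsOddNet f = ∀ y → InImage (conj f) y ⇔ IsOddPt y

set : ∀ {n} → Point n → Fin n → Bool → Point n
set x j α i with i ≟ j
... | yes _ = α
... | no  _ = x i

-- arc from j to i in Gf(x): f_ij(x) ≠ 0, i.e. f_i(x^{j1}) ≠ f_i(x^{j0})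
-- (the sign of the arc is irrelevant for out-degrees and cycles)
Arc : ∀ {n} → Network n → Point n → Fin n → Fin n → Set
Arc f x j i = f (set x j true) i ≢ f (set x j false) i

arc? : ∀ {n} (f : Network n) (x : Point n) (j i : Fin n) → Dec (Arc f x j i)
arc? f x j i = ¬? (f (set x j true) i ≟ᵇ f (set x j false) i)

outDegree : ∀ {n} → Network n → Point n → Fin n → ℕ
outDegree {n} f x j = length (filter (arc? f x j) (allFin n))

-- a cycle of length suc k in Gf(x): distinct vertices c 0, …, c k with arcs
-- c t → c (t+1) and c k → c 0 (k = 0 gives a loop)
HasCycle : ∀ {n} → Network n → Point n → Set
HasCycle {n} f x =
  Σ ℕ λ k → Σ (Fin (suc k) → Fin n) λ c →
    Injective _≡_ _≡_ c
    × (∀ (t : Fin k) → Arc f x (c (inject₁ t)) (c (suc t)))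
    × Arc f x (c (fromℕ k)) (c zero)

module Submission where

-- The conjugate f̃ of an even or odd network takes values of a single parity.
-- Since x^{j1} ⊕ x^{j0} is the unit vector e_j, the point
-- f̃(x^{j1}) ⊕ f̃(x^{j0}) = (f(x^{j1}) ⊕ f(x^{j0})) ⊕ e_j has even weight, so
-- f(x^{j1}) ⊕ f(x^{j0}), whose ones are the out-neighbours of j in Gf(x), has
-- odd weight. In particular every vertex has an out-neighbour, and following
-- out-arcs from any vertex of the finite set V must revisit a vertex: the first
-- repetition closes a cycle.

open import Defs
open import Algebra.Bundles using (CommutativeRing)
open import Data.Bool using (Bool; true; false; not; _xor_; if_then_else_)
open import Data.Bool.Properties
  using (xor-same; xor-comm; not-injective; xor-∧-commutativeRing) renaming (_≟_ to _≟ᵇ_)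
open import Data.Empty using (⊥-elim)
open import Data.Fin using (Fin; zero; suc; toℕ; fromℕ; fromℕ<; inject₁; _≟_)
open import Data.Fin.Properties as F
  using (¬∀⟶∃¬-smallest; toℕ-fromℕ; toℕ-fromℕ<; toℕ-inject; toℕ-inject₁; toℕ<n)
open import Data.List using (List; []; _∷_; length; filter; tabulate; allFin)
open import Data.List.Relation.Unary.All using ([]; _∷_)
open import Data.List.Relation.Unary.All.Properties using (all-filter)
open import Data.Nat using (ℕ; zero; suc; _+_; _%_; _<_; _≤_; s≤s; s≤s⁻¹)
open import Data.Nat.DivMod using (%-distribˡ-+)
open import Data.Nat.GeneralisedArithmetic using (fold; fold-+)
open import Data.Nat.Properties using (n<1+n; +-comm; +-monoˡ-≤; +-monoˡ-<; m≤n⇒∃[o]m+o≡n)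
open import Data.Product using (Σ; ∃; ∃₂; _×_; _,_; proj₁; proj₂)
open import Data.Sum using (_⊎_; inj₁; inj₂)
open import Function using (_∘_)
open import Function.Bundles using (Equivalence)
open import Function.Definitions using (Injective)
open import Relation.Binary.Definitions using (tri<; tri≈; tri>)
open import Relation.Binary.PropositionalEquality
  using (_≡_; _≢_; refl; sym; trans; cong; cong₂; subst; subst₂; module ≡-Reasoning)
open import Relation.Nullary using (¬_; ¬?; does; yes; no)
open import Relation.Nullary.Decidable using (decidable-stable)
open import Relation.Unary using (Decidable)

open import Algebra.Properties.CommutativeSemigroup
  (CommutativeRing.+-commutativeSemigroup xor-∧-commutativeRing) using (interchange)

bit : Bool → ℕ
bit b = if b then 1 else 0

bit-injective : ∀ {a b} → bit a ≡ bit b → a ≡ b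
bit-injective {false} {false} _ = refl
bit-injective {true}  {true}  _ = refl

suc-%2 : ∀ n {b} → n % 2 ≡ bit b → suc n % 2 ≡ bit (not b)
suc-%2 n {b} n%2 = trans (%-distribˡ-+ 1 n 2) (trans (cong (λ r → suc r % 2) n%2) (flip b))
  where
  flip : ∀ b → suc (bit b) % 2 ≡ bit (not b)
  flip false = refl
  flip true  = refl

parity : ∀ {n} → (Fin n → Bool) → Bool
parity {zero}  p = false
parity {suc n} p = p zero xor parity (p ∘ suc)

parity-cong : ∀ {n} {p q : Fin n → Bool} → (∀ i → p i ≡ q i) → parity p ≡ parity q
parity-cong {zero}  e = refl
parity-cong {suc n} e = cong₂ _xor_ (e zero) (parity-cong (e ∘ suc))

parity-xor : ∀ {n} (p q : Fin n → Bool) → parity (λ i → p i xor q i) ≡ parity p xor parity q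
parity-xor {zero}  p q = refl
parity-xor {suc n} p q = trans (cong ((p zero xor q zero) xor_) (parity-xor (p ∘ suc) (q ∘ suc)))
  (interchange (p zero) (q zero) (parity (p ∘ suc)) (parity (q ∘ suc)))

parity-false : ∀ n → parity {n} (λ _ → false) ≡ false
parity-false zero    = refl
parity-false (suc n) = parity-false n

parity-indicator : ∀ {n} (j : Fin n) → parity (λ i → does (i ≟ j)) ≡ true
parity-indicator {suc n} zero    = cong (true xor_) (parity-false n)
parity-indicator {suc n} (suc j) = parity-indicator j

count-%2 : ∀ {a} {A : Set a} {P : A → Set} (P? : Decidable P) {n} (g : Fin n → A) →
  length (filter P? (tabulate g)) % 2 ≡ bit (parity (does ∘ P? ∘ g))
count-%2 P? {zero}  g = refl
count-%2 P? {suc n} g with does (P? (g zero))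
... | true  = suc-%2 (length (filter P? (tabulate (g ∘ suc)))) (count-%2 P? (g ∘ suc))
... | false = count-%2 P? (g ∘ suc)

weight-%2 : ∀ {n} (y : Point n) → weight y % 2 ≡ bit (parity y)
weight-%2 y = trans (count-%2 (λ i → y i ≟ᵇ true) (λ i → i)) (cong bit (parity-cong (does-≟-true ∘ y)))
  where
  does-≟-true : ∀ b → does (b ≟ᵇ true) ≡ b
  does-≟-true false = refl
  does-≟-true true  = refl

image-weight-%2 : ∀ {n} (f : Network n) → IsEvenNet f ⊎ IsOddNet f →
  ∃ λ r → ∀ u → weight (conj f u) % 2 ≡ r
image-weight-%2 f (inj₁ even) = 0 , λ u → Equivalence.to (even (conj f u)) (u , λ _ → refl)
image-weight-%2 f (inj₂ odd)  = 1 , λ u → Equivalence.to (odd (conj f u))  (u , λ _ → refl)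

conj-parity-constant : ∀ {n} (f : Network n) → IsEvenNet f ⊎ IsOddNet f →
  ∀ u v → parity (conj f u) ≡ parity (conj f v)
conj-parity-constant f h u v with image-weight-%2 f h
... | r , weight≡r = bit-injective (begin
  bit (parity (conj f u)) ≡⟨ sym (weight-%2 (conj f u)) ⟩
  weight (conj f u) % 2   ≡⟨ trans (weight≡r u) (sym (weight≡r v)) ⟩
  weight (conj f v) % 2   ≡⟨ weight-%2 (conj f v) ⟩
  bit (parity (conj f v)) ∎)
  where open ≡-Reasoning

module _ {n} (f : Network n) (x : Point n) (j : Fin n) where

  sensitivity : Point n
  sensitivity i = f (set x j true) i xor f (set x j false) i

  outDegree-%2 : outDegree f x j % 2 ≡ bit (parity sensitivity)
  outDegree-%2 = trans (count-%2 (arc? f x j) (λ i → i)) (cong bit (parity-cong does-arc?≡sensitivity))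
    where
    does-arc?≡sensitivity : ∀ i → does (arc? f x j i) ≡ sensitivity i
    does-arc?≡sensitivity i with f (set x j true) i | f (set x j false) i
    ... | true  | true  = refl
    ... | true  | false = refl
    ... | false | true  = refl
    ... | false | false = refl

  set-xor : ∀ i → set x j true i xor set x j false i ≡ does (i ≟ j)
  set-xor i with i ≟ j
  ... | yes _ = refl
  ... | no  _ = xor-same (x i)

  conj-set-xor : ∀ i → conj f (set x j true) i xor conj f (set x j false) i ≡ sensitivity i xor does (i ≟ j)
  conj-set-xor i = trans
    (interchange (f (set x j true) i) (set x j true i) (f (set x j false) i) (set x j false i))
    (cong (sensitivity i xor_) (set-xor i))

  parity-conj-set : parity (conj f (set x j true)) xor parity (conj f (set x j false)) ≡ not (parity sensitivity)
  parity-conj-set = begin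
    parity (conj f (set x j true)) xor parity (conj f (set x j false))
      ≡⟨ sym (parity-xor (conj f (set x j true)) (conj f (set x j false))) ⟩
    parity (λ i → conj f (set x j true) i xor conj f (set x j false) i)
      ≡⟨ parity-cong conj-set-xor ⟩
    parity (λ i → sensitivity i xor does (i ≟ j))
      ≡⟨ parity-xor sensitivity (λ i → does (i ≟ j)) ⟩
    parity sensitivity xor parity (λ i → does (i ≟ j))
      ≡⟨ cong (parity sensitivity xor_) (parity-indicator j) ⟩
    parity sensitivity xor true
      ≡⟨ xor-comm (parity sensitivity) true ⟩
    not (parity sensitivity) ∎
    where open ≡-Reasoning

  outDegree-odd : IsEvenNet f ⊎ IsOddNet f → outDegree f x j % 2 ≡ 1
  outDegree-odd h = trans outDegree-%2 (cong bit (not-injective (begin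
    not (parity sensitivity)                    ≡⟨ sym parity-conj-set ⟩
    parity conj₁ xor parity conj₀               ≡⟨ cong (_xor parity conj₀) (conj-parity-constant f h _ _) ⟩
    parity conj₀ xor parity conj₀               ≡⟨ xor-same (parity conj₀) ⟩
    false                                       ∎)))
    where
    open ≡-Reasoning
    conj₁ conj₀ : Point n
    conj₁ = conj f (set x j true)
    conj₀ = conj f (set x j false)

filter-odd⇒∃ : ∀ {a} {A : Set a} {P : A → Set} (P? : Decidable P) (l : List A) →
  length (filter P? l) % 2 ≡ 1 → ∃ P
filter-odd⇒∃ P? l with filter P? l | all-filter P? l
... | []    | _        = λ ()
... | a ∷ _ | Pa ∷ _   = λ _ → a , Pa

least-satisfier : ∀ {P : ℕ → Set} → Decidable P → ∀ {m} → P m → ∃ λ j → P j × (∀ {i} → i < j → ¬ P i)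
least-satisfier {P} P? {m} Pm
  with ¬∀⟶∃¬-smallest (suc m) (¬_ ∘ P ∘ toℕ) (¬? ∘ P? ∘ toℕ)
         (λ ¬P → ¬P (fromℕ m) (subst P (sym (toℕ-fromℕ m)) Pm))
... | j , ¬¬Pj , below = toℕ j , decidable-stable (P? (toℕ j)) ¬¬Pj , λ i<j →
  subst (¬_ ∘ P) (trans (toℕ-inject (fromℕ< i<j)) (toℕ-fromℕ< i<j)) (below (fromℕ< i<j))

injective-if-<-distinct : ∀ {m} {A : Set} (c : Fin m → A) → (∀ {a b} → toℕ a < toℕ b → c a ≢ c b) →
  Injective _≡_ _≡_ c
injective-if-<-distinct c distinct {a} {b} eq with F.<-cmp a b
... | tri< a<b _ _ = ⊥-elim (distinct a<b eq)
... | tri≈ _ a≡b _ = a≡b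
... | tri> _ _ b<a = ⊥-elim (distinct b<a (sym eq))

Cycle : ∀ {n} → (Fin n → Fin n → Set) → Set
Cycle {n} R =
  Σ ℕ λ k → Σ (Fin (suc k) → Fin n) λ c →
    Injective _≡_ _≡_ c
    × (∀ (t : Fin k) → R (c (inject₁ t)) (c (suc t)))
    × R (c (fromℕ k)) (c zero)

module _ {n} (s : Fin n → Fin n) where

  Repeats : Fin n → ℕ → Set
  Repeats v j = ∃ λ (i : Fin j) → fold v s (toℕ i) ≡ fold v s j

  repeats? : ∀ v → Decidable (Repeats v)
  repeats? v j = F.any? (λ i → fold v s (toℕ i) ≟ fold v s j)

  repeats-eventually : ∀ v → ∃ (Repeats v)
  repeats-eventually v with F.pigeonhole (n<1+n n) (λ t → fold v s (toℕ t))
  ... | a , b , a<b , e = toℕ b , fromℕ< a<b , trans (cong (fold v s) (toℕ-fromℕ< a<b)) e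

  -- If the j-th iterate of v is the least one repeating an earlier iterate, the
  -- i-th, then the iterates i, …, j - 1 are distinct and s maps the last to the first.
  periodic-point : Fin n → ∃₂ λ k w →
    Injective _≡_ _≡_ (λ (t : Fin (suc k)) → fold w s (toℕ t)) × s (fold w s k) ≡ w
  periodic-point v with least-satisfier (repeats? v) (proj₂ (repeats-eventually v))
  ... | j , (i , repeat) , first with m≤n⇒∃[o]m+o≡n (toℕ<n i)
  ... | k , 1+i+k≡j = k , w , injective-if-<-distinct _ (λ {a} {b} a<b → distinct a<b (s≤s⁻¹ (toℕ<n b))) , closes
    where
    w : Fin n
    w = fold v s (toℕ i)

    distinct : ∀ {a b} → a < b → b ≤ k → fold w s a ≢ fold w s b
    distinct {a} {b} a<b b≤k eq = first b+i<j (fromℕ< a+i<b+i ,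
      trans (cong (fold v s) (toℕ-fromℕ< a+i<b+i)) (begin
        fold v s (a + toℕ i) ≡⟨ fold-+ v s a ⟩
        fold w s a           ≡⟨ eq ⟩
        fold w s b           ≡⟨ fold-+ v s b ⟨
        fold v s (b + toℕ i) ∎))
      where
      open ≡-Reasoning
      a+i<b+i : a + toℕ i < b + toℕ i
      a+i<b+i = +-monoˡ-< (toℕ i) a<b
      b+i<j : b + toℕ i < j
      b+i<j = subst (b + toℕ i <_) 1+i+k≡j
        (s≤s (subst (b + toℕ i ≤_) (+-comm k (toℕ i)) (+-monoˡ-≤ (toℕ i) b≤k)))

    closes : s (fold w s k) ≡ w
    closes = begin
      fold w s (suc k)           ≡⟨ fold-+ v s (suc k) ⟨
      fold v s (suc k + toℕ i)   ≡⟨ cong (fold v s ∘ suc) (+-comm k (toℕ i)) ⟩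
      fold v s (suc (toℕ i) + k) ≡⟨ cong (fold v s) 1+i+k≡j ⟩
      fold v s j                 ≡⟨ repeat ⟨
      w                          ∎
      where open ≡-Reasoning

module _ {n} (R : Fin n → Fin n → Set) (s : Fin n → Fin n) (s-R : ∀ v → R v (s v)) where

  orbit⇒cycle : ∀ k w → Injective _≡_ _≡_ (λ (t : Fin (suc k)) → fold w s (toℕ t)) →
    s (fold w s k) ≡ w → Cycle R
  orbit⇒cycle k w injective closes = k , (λ t → fold w s (toℕ t)) , injective , arcs , last
    where
    arcs : ∀ t → R (fold w s (toℕ (inject₁ t))) (fold w s (suc (toℕ t)))
    arcs t = subst (λ r → R (fold w s r) (s (fold w s (toℕ t)))) (sym (toℕ-inject₁ t)) (s-R _)
    last : R (fold w s (toℕ (fromℕ k))) w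
    last = subst₂ (λ r u → R (fold w s r) u) (sym (toℕ-fromℕ k)) closes (s-R _)

total⇒cycle : ∀ {n} (R : Fin n → Fin n → Set) → (∀ v → ∃ (R v)) → Fin n → Cycle R
total⇒cycle R total v =
  let k , w , injective , closes = periodic-point (proj₁ ∘ total) v
  in orbit⇒cycle R (proj₁ ∘ total) (proj₂ ∘ total) k w injective closes

proposition4 : (m : ℕ) (f : Network (suc m)) → IsEvenNet f ⊎ IsOddNet f →
    (x : Point (suc m)) →
      ((j : Fin (suc m)) → outDegree f x j % 2 ≡ 1) × HasCycle f x
proposition4 m f h x = odd-degree , total⇒cycle (Arc f x) has-arc zero
  where
  odd-degree : (j : Fin (suc m)) → outDegree f x j % 2 ≡ 1
  odd-degree j = outDegree-odd f x j h
  has-arc : ∀ j → ∃ (Arc f x j)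
  has-arc j = filter-odd⇒∃ (arc? f x j) (allFin (suc m)) (odd-degree j)
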